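{- Let $s$ be a non-negative integer and let $R$ be an $(sP_1+P_3)$-free tree. Then either (i) $|V(R)|\leq \max\{7,4s-2\}$, or (ii) $R$ has precisely one vertex $r$ of degree more than $2$ and at most $s-1$ vertices of degree $2$, each of which is adjacent to $r$; moreover, $r$ has at least $3s-1$ neighbours.
   Context: $sP_1+P_3$ denotes the disjoint union of an edgeless graph on $s$ vertices and a path on $3$ vertices (for $s=0$ it is just $P_3$). A graph is $F$-free if it has no induced subgraph isomorphic to $F$. -}

module Defs where

open import Data.Nat using (ℕ; zero; suc; _+_; _≤_)
open import Data.Fin using (Fin; toℕ)
open import Data.Bool using (Bool; true; false; T; _∧_; _∨_)
open import Data.List using (List; []; _∷_; _++_; [_]; length; filterᵇ; allFin)
open import Data.List.Relation.Unary.Linked using (Linked)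
open import Data.List.Relation.Unary.Unique.Propositional using (Unique)
open import Data.Product using (Σ; _×_; ∃)
open import Relation.Binary.PropositionalEquality using (_≡_)
open import Relation.Nullary using (¬_)
open import Function using (Injective)

record Graph : Set where
  field
    n     : ℕ
    adj   : Fin n → Fin n → Bool
    sym   : ∀ u v → adj u v ≡ adj v u
    irrefl : ∀ v → adj v v ≡ false
open Graph public

Adj : (G : Graph) → Fin (n G) → Fin (n G) → Set
Adj G u v = T (adj G u v)

deg : (G : Graph) → Fin (n G) → ℕ
deg G v = length (filterᵇ (adj G v) (allFin (n G)))

data Walk (G : Graph) : Fin (n G) → Fin (n G) → Set where
  here : ∀ {u} → Walk G u u
  step : ∀ {u v w} → Adj G u v → Walk G v w → Walk G u w

Connected : Graph → Set
Connected G = ∀ u v → Walk G u v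

IsCycle : (G : Graph) → Fin (n G) → List (Fin (n G)) → Set
IsCycle G x xs = (2 ≤ length xs) × Unique (x ∷ xs) × Linked (Adj G) (x ∷ xs ++ [ x ])

Acyclic : Graph → Set
Acyclic G = ∀ x xs → ¬ IsCycle G x xs

IsTree : Graph → Set
IsTree G = (1 ≤ n G) × Connected G × Acyclic G

InducedSub : Graph → Graph → Set
InducedSub H G = Σ (Fin (n H) → Fin (n G)) λ f →
  Injective _≡_ _≡_ f × (∀ i j → adj G (f i) (f j) ≡ adj H i j)

Free : Graph → Graph → Set
Free H G = ¬ InducedSub H G

-- sP₁ + P₃ on Fin (3 + s): vertices 0 - 1 - 2 form the path, the rest are isolated
pathAdj : ℕ → ℕ → Bool
pathAdj 0 1 = true
pathAdj 1 0 = true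
pathAdj 1 2 = true
pathAdj 2 1 = true
pathAdj _ _ = false

private
  pathAdj-sym : ∀ a b → pathAdj a b ≡ pathAdj b a
  pathAdj-sym 0 0 = _≡_.refl
  pathAdj-sym 0 1 = _≡_.refl
  pathAdj-sym 0 2 = _≡_.refl
  pathAdj-sym 0 (suc (suc (suc b))) = _≡_.refl
  pathAdj-sym 1 0 = _≡_.refl
  pathAdj-sym 1 1 = _≡_.refl
  pathAdj-sym 1 2 = _≡_.refl
  pathAdj-sym 1 (suc (suc (suc b))) = _≡_.refl
  pathAdj-sym 2 0 = _≡_.refl
  pathAdj-sym 2 1 = _≡_.refl
  pathAdj-sym 2 2 = _≡_.refl
  pathAdj-sym 2 (suc (suc (suc b))) = _≡_.refl
  pathAdj-sym (suc (suc (suc a))) 0 = _≡_.refl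
  pathAdj-sym (suc (suc (suc a))) 1 = _≡_.refl
  pathAdj-sym (suc (suc (suc a))) 2 = _≡_.refl
  pathAdj-sym (suc (suc (suc a))) (suc (suc (suc b))) = _≡_.refl

  pathAdj-irr : ∀ a → pathAdj a a ≡ false
  pathAdj-irr 0 = _≡_.refl
  pathAdj-irr 1 = _≡_.refl
  pathAdj-irr 2 = _≡_.refl
  pathAdj-irr (suc (suc (suc a))) = _≡_.refl

sP1+P3 : ℕ → Graph
sP1+P3 s = record
  { n = 3 + s
  ; adj = λ i j → pathAdj (toℕ i) (toℕ j)
  ; sym = λ i j → pathAdj-sym (toℕ i) (toℕ j)
  ; irrefl = λ i → pathAdj-irr (toℕ i)
  }

count : ∀ {m} → (Fin m → Bool) → ℕ
count {m} p = length (filterᵇ p (allFin m))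

-- Root R at a vertex r of maximum degree and 2-colour it by the parity of depth. If a vertex y
-- with parent p has an induced P₃ among its descendants and another one avoiding them, then every
-- vertex other than y and p is neither on nor adjacent to one of the two P₃s. Such far vertices of
-- one colour are independent, so fewer than s of them exist (else they complete the P₃ to an
-- induced sP₁ + P₃), whence n ≤ 4s − 2. For larger n this forces deg r ≥ 3, all other degrees
-- ≤ 2, every degree-2 vertex to be a neighbour of r, and hence all depths ≤ 2. If r has two leaf
-- neighbours l₁, l₂, the depth-2 vertices (one child of each degree-2 neighbour of r) are far from
-- l₁ r l₂, so there are at most s − 1 of them and deg r ≥ 3s − 1; otherwise nearly all neighbours
-- of r have degree 2, and a P₃ e m r through one of them gives n ≤ 2s + 2 ≤ max(7, 4s − 2).

module Submission where

open import Data.Bool using (true; false; T)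
open import Data.Empty using (⊥; ⊥-elim)
open import Data.Fin using (Fin; zero; suc; inject≤; fromℕ<; toℕ)
open import Data.Fin.Properties using (injective⇒≤; inject≤-injective; _≟_; toℕ-fromℕ<)
open import Data.List using (List; []; _∷_; _++_; [_]; length; lookup; filter; allFin)
open import Data.List.Extrema.Nat using (argmax; f[xs]≤f[argmax])
open import Data.List.Membership.Propositional using (_∈_; _∉_)
open import Data.List.Membership.Propositional.Properties
  using (∈-lookup; ∈-allFin; ∈-filter⁺; ∈-filter⁻; ∈-∃++; ∈-++⁺ˡ; ∈-++⁺ʳ)
open import Data.List.Properties using (filter-≐)
open import Data.List.Relation.Unary.All as All using (All; []; _∷_; all?)
open import Data.List.Relation.Unary.All.Properties using (¬Any⇒All¬; ++⁻ˡ)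
open import Data.List.Relation.Unary.AllPairs using ([]; _∷_)
open import Data.List.Relation.Unary.Any as Any using (here; there)
open import Data.List.Relation.Unary.Any.Properties using (lookup-index)
open import Data.List.Relation.Unary.Linked using (Linked; []; [-]; _∷_)
open import Data.List.Relation.Unary.Unique.Propositional using (Unique)
import Data.List.Relation.Unary.Unique.Propositional.Properties as Unique
open import Data.Maybe using (Maybe; nothing; just)
import Data.Maybe.Properties as MaybeP
open import Data.Nat using (ℕ; zero; suc; _+_; _*_; _∸_; _≤_; _<_; _⊔_; _≡ᵇ_; s≤s; z≤n; _≤?_; parity)
open import Data.Nat.Properties
  using ( ≤-trans; ≤-reflexive; ≤-antisym; ≤-pred; ≰⇒>; <-trans; <-irrefl; <-asym; <⇒≤; <⇒≱; ≤-<-trans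
        ; +-comm; +-suc; +-mono-≤; +-monoˡ-≤; +-monoʳ-≤; +-cancelˡ-≤; *-monoˡ-≤; n≤1+n; m≤n⇒m≤1+n
        ; 0≢1+n; suc-injective; m+n≤o⇒m≤o∸n; m≤n+m∸n; m+[n∸m]≡n; m≤m⊔n; m≤n⊔m; <-≤-trans; ≡ᵇ⇒≡; ≡⇒≡ᵇ
        ; module ≤-Reasoning )
  renaming (_≟_ to _≟ℕ_)
open import Data.Nat.Tactic.RingSolver using (solve-∀)
open import Data.Parity using (Parity; 0ℙ; 1ℙ)
open import Data.Parity.Properties using (p≢p⁻¹; suc-homo-⁻¹) renaming (_≟_ to _≟ᴾ_)
open import Data.Product using (Σ; _×_; _,_; proj₁; proj₂)
open import Data.Sum as Sum using (_⊎_; inj₁; inj₂; [_,_]′)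
open import Function using (_∘_; id; Injective; case_of_)
open import Level using (0ℓ)
open import Relation.Binary.PropositionalEquality
  using (_≡_; _≢_; refl; sym; trans; cong; subst; subst₂; ≢-sym; module ≡-Reasoning)
open import Relation.Nullary using (¬_; Dec; yes; no; ¬?; _×-dec_)
open import Relation.Nullary.Decidable as Dec using (T?; dec-true; dec-false)
open import Relation.Unary using (Pred; Decidable; _⊆_; _∪_; _≐_; ∁)
open import Relation.Unary.Properties using (U?; _∪?_)

open import Defs hiding (sym)

lookup-injective : ∀ {A : Set} {xs : List A} → Unique xs → Injective _≡_ _≡_ (lookup xs)
lookup-injective {xs = _ ∷ _}  _           {zero}  {zero}  _  = refl
lookup-injective {xs = _ ∷ _}  (x∉ ∷ _)    {zero}  {suc j} eq = ⊥-elim (All.lookup x∉ (∈-lookup j) eq)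
lookup-injective {xs = _ ∷ _}  (x∉ ∷ _)    {suc i} {zero}  eq = ⊥-elim (All.lookup x∉ (∈-lookup i) (sym eq))
lookup-injective {xs = _ ∷ _}  (_ ∷ uniq)  {suc i} {suc j} eq = cong suc (lookup-injective uniq eq)

module _ {m : ℕ} where

  countᵈ : {P : Pred (Fin m) 0ℓ} → Decidable P → ℕ
  countᵈ P? = length (filter P? (allFin m))

  record Distinct (k : ℕ) (P : Pred (Fin m) 0ℓ) : Set where
    constructor distinct
    field
      element   : Fin k → Fin m
      injective : Injective _≡_ _≡_ element
      satisfies : ∀ i → P (element i)

  distinct-one : ∀ {P} → Distinct 1 P → Σ (Fin m) P
  distinct-one (distinct g _ g∈P) = g zero , g∈P zero

  distinct-pair : ∀ {P} → Distinct 2 P → Σ (Fin m) λ x → Σ (Fin m) λ y → P x × P y × x ≢ y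
  distinct-pair (distinct g g-inj g∈P) =
    g zero , g (suc zero) , g∈P zero , g∈P (suc zero) , λ eq → case g-inj eq of λ ()

  module _ {P : Pred (Fin m) 0ℓ} (P? : Decidable P) where

    private
      elements : List (Fin m)
      elements = filter P? (allFin m)

      elements-unique : Unique elements
      elements-unique = Unique.filter⁺ P? (Unique.allFin⁺ m)

    enumerate : Distinct (countᵈ P?) P
    enumerate = distinct (lookup elements) (lookup-injective elements-unique)
                λ i → proj₂ (∈-filter⁻ P? {xs = allFin m} (∈-lookup i))

    distinct⇒≤countᵈ : ∀ {k} → Distinct k P → k ≤ countᵈ P?
    distinct⇒≤countᵈ (distinct g g-inj g∈P) = injective⇒≤ position-injective
      where
      position : ∀ i → g i ∈ elements
      position i = ∈-filter⁺ P? (∈-allFin (g i)) (g∈P i)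
      position-injective : Injective _≡_ _≡_ (Any.index ∘ position)
      position-injective {i} {j} eq = g-inj (begin
        g i                                       ≡⟨ lookup-index (position i) ⟩
        lookup elements (Any.index (position i))  ≡⟨ cong (lookup elements) eq ⟩
        lookup elements (Any.index (position j))  ≡⟨ sym (lookup-index (position j)) ⟩
        g j                                       ∎)
        where open ≡-Reasoning

    ≤countᵈ⇒distinct : ∀ {k} → k ≤ countᵈ P? → Distinct k P
    ≤countᵈ⇒distinct k≤ with distinct g g-inj g∈P ← enumerate =
      distinct (λ i → g (inject≤ i k≤)) (λ eq → inject≤-injective k≤ k≤ _ _ (g-inj eq)) (λ i → g∈P _)

    countᵈ-≤1 : ∀ {z} → (∀ {x} → P x → x ≡ z) → countᵈ P? ≤ 1
    countᵈ-≤1 {z} P⊆z with distinct g g-inj g∈P ← enumerate =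
      injective⇒≤ {f = λ (_ : Fin (countᵈ P?)) → zero {0}}
        (λ _ → g-inj (trans (P⊆z (g∈P _)) (sym (P⊆z (g∈P _)))))

  module _ {P Q : Pred (Fin m) 0ℓ} (P? : Decidable P) (Q? : Decidable Q) where

    countᵈ-≐ : P ≐ Q → countᵈ P? ≡ countᵈ Q?
    countᵈ-≐ P≐Q = cong length (filter-≐ P? Q? P≐Q (allFin m))

    countᵈ-injection : (f : ∀ {x} → P x → Fin m) → (∀ {x} (px : P x) → Q (f px)) →
                       (∀ {x y} (px : P x) (py : P y) → f px ≡ f py → x ≡ y) → countᵈ P? ≤ countᵈ Q?
    countᵈ-injection f f∈Q f-inj with distinct g g-inj g∈P ← enumerate P? =
      distinct⇒≤countᵈ Q? (distinct (λ i → f (g∈P i)) (g-inj ∘ f-inj (g∈P _) (g∈P _)) (f∈Q ∘ g∈P))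

  module _ {P Q R : Pred (Fin m) 0ℓ} (P? : Decidable P) (Q? : Decidable Q) (R? : Decidable R) where

    countᵈ-∪ : P ⊆ Q ∪ R → countᵈ P? ≤ countᵈ Q? + countᵈ R?
    countᵈ-∪ P⊆Q∪R = length-filter-∪ (allFin m)
      where
      length-filter-∪ : ∀ xs → length (filter P? xs) ≤ length (filter Q? xs) + length (filter R? xs)
      length-filter-∪ [] = z≤n
      length-filter-∪ (x ∷ xs) with ih ← length-filter-∪ xs | Q? x | R? x | P? x
      ... | yes _ | yes _ | yes _ = s≤s (≤-trans ih (+-monoʳ-≤ _ (n≤1+n _)))
      ... | yes _ | yes _ | no _  = ≤-trans ih (+-mono-≤ (n≤1+n _) (n≤1+n _))
      ... | yes _ | no _  | yes _ = s≤s ih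
      ... | yes _ | no _  | no _  = m≤n⇒m≤1+n ih
      ... | no _  | yes _ | yes _ =
        subst (suc (length (filter P? xs)) ≤_)
              (sym (+-suc (length (filter Q? xs)) (length (filter R? xs)))) (s≤s ih)
      ... | no _  | yes _ | no _  = ≤-trans ih (+-monoʳ-≤ _ (n≤1+n _))
      ... | no ¬q | no ¬r | yes p = ⊥-elim ([ ¬q , ¬r ]′ (P⊆Q∪R p))
      ... | no _  | no _  | no _  = ih

  module _ {P : Pred (Fin m) 0ℓ} (P? : Decidable P) (e : Fin m) where

    except? : Decidable (λ x → P x × x ≢ e)
    except? x = P? x ×-dec ¬? (x ≟ e)

    countᵈ-except : countᵈ P? ≤ suc (countᵈ except?)
    countᵈ-except = begin
      countᵈ P?                          ≤⟨ countᵈ-∪ P? except? (_≟ e) split ⟩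
      countᵈ except? + countᵈ (_≟ e)     ≤⟨ +-monoʳ-≤ (countᵈ except?) (countᵈ-≤1 (_≟ e) id) ⟩
      countᵈ except? + 1                 ≡⟨ +-comm (countᵈ except?) 1 ⟩
      suc (countᵈ except?)               ∎
      where
      open ≤-Reasoning
      split : P ⊆ (λ x → P x × x ≢ e) ∪ (_≡ e)
      split {x} px with x ≟ e
      ... | yes x≡e = inj₂ x≡e
      ... | no x≢e  = inj₁ (px , x≢e)

  module _ {Q R : Pred (Fin m) 0ℓ} (Q? : Decidable Q) (R? : Decidable R) where

    covering : (∀ x → Q x ⊎ R x) → m ≤ countᵈ Q? + countᵈ R?
    covering cover = ≤-trans (distinct⇒≤countᵈ U? (distinct id id _)) (countᵈ-∪ U? Q? R? λ {x} _ → cover x)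

Vertex : Graph → Set
Vertex G = Fin (n G)

module Adjacency (G : Graph) where

  Adj-sym : ∀ {u v} → Adj G u v → Adj G v u
  Adj-sym {u} {v} = subst T (Graph.sym G u v)

  Adj-irrefl : ∀ {v} → ¬ Adj G v v
  Adj-irrefl {v} = subst T (Graph.irrefl G v)

  Adj⇒≢ : ∀ {u v} → Adj G u v → u ≢ v
  Adj⇒≢ u~v refl = Adj-irrefl u~v

  adjacent? : (u : Vertex G) → Decidable (Adj G u)
  adjacent? u v = T? (adj G u v)

  neighbours⇒≤deg : ∀ {v us} → Unique us → All (Adj G v) us → length us ≤ deg G v
  neighbours⇒≤deg {v} {us} us-unique us~v =
    distinct⇒≤countᵈ (adjacent? v)
      (distinct (lookup us) (lookup-injective us-unique) λ i → All.lookup us~v (∈-lookup i))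

  two-neighbours : ∀ {v a b} → Adj G v a → Adj G v b → a ≢ b → 2 ≤ deg G v
  two-neighbours v~a v~b a≢b = neighbours⇒≤deg ((a≢b ∷ []) ∷ [] ∷ []) (v~a ∷ v~b ∷ [])

  three-neighbours : ∀ {v a b c} → Adj G v a → Adj G v b → Adj G v c → a ≢ b → a ≢ c → b ≢ c → 3 ≤ deg G v
  three-neighbours v~a v~b v~c a≢b a≢c b≢c =
    neighbours⇒≤deg ((a≢b ∷ a≢c ∷ []) ∷ (b≢c ∷ []) ∷ [] ∷ []) (v~a ∷ v~b ∷ v~c ∷ [])

  neighbours-avoiding : ∀ {k v} → suc k ≤ deg G v → (e : Vertex G) → Distinct k (λ u → Adj G v u × u ≢ e)
  neighbours-avoiding {k} {v} k<deg e =
    ≤countᵈ⇒distinct (except? (adjacent? v) e) (≤-pred (≤-trans k<deg (countᵈ-except (adjacent? v) e)))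

Independent : (G : Graph) → Pred (Vertex G) 0ℓ → Set
Independent G I = ∀ {x y} → I x → I y → ¬ Adj G x y

record InducedP₃ (G : Graph) : Set where
  field
    a b c : Vertex G
    a~b   : Adj G a b
    b~c   : Adj G b c
    a≁c   : ¬ Adj G a c
    a≢c   : a ≢ c

  corners : List (Vertex G)
  corners = a ∷ b ∷ c ∷ []

module _ {G : Graph} where
  open Adjacency G

  Far : InducedP₃ G → Pred (Vertex G) 0ℓ
  Far P x = All (λ t → x ≢ t × ¬ Adj G t x) (InducedP₃.corners P)

  far? : (P : InducedP₃ G) → Decidable (Far P)
  far? P x = all? (λ t → ¬? (x ≟ t) ×-dec ¬? (adjacent? t x)) _

  module _ {s : ℕ} (free : Free (sP1+P3 s) G) (P : InducedP₃ G) where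
    open InducedP₃ P

    far-independent-count : {I : Pred (Vertex G) 0ℓ} (I? : Decidable I) →
                            I ⊆ Far P → Independent G I → countᵈ I? < s
    far-independent-count I? I⊆far independent with s ≤? countᵈ I?
    ... | no s≰ = ≰⇒> s≰
    ... | yes s≤ = ⊥-elim (free (embedding , embedding-injective , embedding-adj))
      where
      open Distinct (≤countᵈ⇒distinct I? s≤) renaming (element to g; injective to g-injective; satisfies to g∈I)
      far : ∀ i → Far P (g i)
      far i = I⊆far (g∈I i)
      ≢a : ∀ i → g i ≢ a
      ≢a i = proj₁ (All.lookup (far i) (here refl))
      ≁a : ∀ i → ¬ Adj G a (g i)
      ≁a i = proj₂ (All.lookup (far i) (here refl))
      ≢b : ∀ i → g i ≢ b
      ≢b i = proj₁ (All.lookup (far i) (there (here refl)))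
      ≁b : ∀ i → ¬ Adj G b (g i)
      ≁b i = proj₂ (All.lookup (far i) (there (here refl)))
      ≢c : ∀ i → g i ≢ c
      ≢c i = proj₁ (All.lookup (far i) (there (there (here refl))))
      ≁c : ∀ i → ¬ Adj G c (g i)
      ≁c i = proj₂ (All.lookup (far i) (there (there (here refl))))

      embedding : Fin (3 + s) → Vertex G
      embedding zero                = a
      embedding (suc zero)          = b
      embedding (suc (suc zero))    = c
      embedding (suc (suc (suc i))) = g i

      true! : ∀ {u v} → Adj G u v → adj G u v ≡ true
      true! {u} {v} = dec-true (T? (adj G u v))
      false! : ∀ {u v} → ¬ Adj G u v → adj G u v ≡ false
      false! {u} {v} = dec-false (T? (adj G u v))
      false!ˢ : ∀ {u v} → ¬ Adj G u v → adj G v u ≡ false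
      false!ˢ u≁v = false! (u≁v ∘ Adj-sym)

      embedding-adj : ∀ i j → adj G (embedding i) (embedding j) ≡ adj (sP1+P3 s) i j
      embedding-adj zero                  zero                  = Graph.irrefl G a
      embedding-adj zero                  (suc zero)            = true! a~b
      embedding-adj zero                  (suc (suc zero))      = false! a≁c
      embedding-adj zero                  (suc (suc (suc j)))   = false! (≁a j)
      embedding-adj (suc zero)            zero                  = true! (Adj-sym a~b)
      embedding-adj (suc zero)            (suc zero)            = Graph.irrefl G b
      embedding-adj (suc zero)            (suc (suc zero))      = true! b~c
      embedding-adj (suc zero)            (suc (suc (suc j)))   = false! (≁b j)
      embedding-adj (suc (suc zero))      zero                  = false!ˢ a≁c
      embedding-adj (suc (suc zero))      (suc zero)            = true! (Adj-sym b~c)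
      embedding-adj (suc (suc zero))      (suc (suc zero))      = Graph.irrefl G c
      embedding-adj (suc (suc zero))      (suc (suc (suc j)))   = false! (≁c j)
      embedding-adj (suc (suc (suc i)))   zero                  = false!ˢ (≁a i)
      embedding-adj (suc (suc (suc i)))   (suc zero)            = false!ˢ (≁b i)
      embedding-adj (suc (suc (suc i)))   (suc (suc zero))      = false!ˢ (≁c i)
      embedding-adj (suc (suc (suc i)))   (suc (suc (suc j)))   = false! (independent (g∈I i) (g∈I j))

      embedding-injective : Injective _≡_ _≡_ embedding
      embedding-injective {zero}                {zero}                _  = refl
      embedding-injective {zero}                {suc zero}            eq = ⊥-elim (Adj⇒≢ a~b eq)
      embedding-injective {zero}                {suc (suc zero)}      eq = ⊥-elim (a≢c eq)
      embedding-injective {zero}                {suc (suc (suc j))}   eq = ⊥-elim (≢a j (sym eq))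
      embedding-injective {suc zero}            {zero}                eq = ⊥-elim (Adj⇒≢ a~b (sym eq))
      embedding-injective {suc zero}            {suc zero}            _  = refl
      embedding-injective {suc zero}            {suc (suc zero)}      eq = ⊥-elim (Adj⇒≢ b~c eq)
      embedding-injective {suc zero}            {suc (suc (suc j))}   eq = ⊥-elim (≢b j (sym eq))
      embedding-injective {suc (suc zero)}      {zero}                eq = ⊥-elim (a≢c (sym eq))
      embedding-injective {suc (suc zero)}      {suc zero}            eq = ⊥-elim (Adj⇒≢ b~c (sym eq))
      embedding-injective {suc (suc zero)}      {suc (suc zero)}      _  = refl
      embedding-injective {suc (suc zero)}      {suc (suc (suc j))}   eq = ⊥-elim (≢c j (sym eq))
      embedding-injective {suc (suc (suc i))}   {zero}                eq = ⊥-elim (≢a i eq)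
      embedding-injective {suc (suc (suc i))}   {suc zero}            eq = ⊥-elim (≢b i eq)
      embedding-injective {suc (suc (suc i))}   {suc (suc zero)}      eq = ⊥-elim (≢c i eq)
      embedding-injective {suc (suc (suc i))}   {suc (suc (suc j))}   eq =
        cong (λ (i : Fin s) → suc (suc (suc i))) (g-injective eq)

≢-≢⇒≡ : ∀ {p q r : Parity} → p ≢ q → q ≢ r → p ≡ r
≢-≢⇒≡ {0ℙ} {0ℙ} p≢q _   = ⊥-elim (p≢q refl)
≢-≢⇒≡ {0ℙ} {1ℙ} {0ℙ} _ _ = refl
≢-≢⇒≡ {0ℙ} {1ℙ} {1ℙ} _ q≢r = ⊥-elim (q≢r refl)
≢-≢⇒≡ {1ℙ} {0ℙ} {0ℙ} _ q≢r = ⊥-elim (q≢r refl)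
≢-≢⇒≡ {1ℙ} {0ℙ} {1ℙ} _ _ = refl
≢-≢⇒≡ {1ℙ} {1ℙ} p≢q _   = ⊥-elim (p≢q refl)

ProperColouring : (G : Graph) → (Vertex G → Parity) → Set
ProperColouring G colour = ∀ {u v} → Adj G u v → colour u ≢ colour v

double-bound : ∀ {x y s} → x < s → y < s → x + y + 2 ≤ 2 * s
double-bound {x} {y} {s} x<s y<s = begin
  x + y + 2          ≡⟨ rearrange x y ⟩
  suc x + suc y      ≤⟨ +-mono-≤ x<s y<s ⟩
  s + s              ≡⟨ double s ⟩
  2 * s              ∎
  where
  open ≤-Reasoning
  rearrange : ∀ x y → x + y + 2 ≡ suc x + suc y
  rearrange = solve-∀
  double : ∀ s → s + s ≡ 2 * s
  double = solve-∀

module Bipartite {G : Graph} {colour : Vertex G → Parity} (proper : ProperColouring G colour) where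
  open Adjacency G

  path⇒induced : ∀ {a b c} → Adj G a b → Adj G b c → a ≢ c → InducedP₃ G
  path⇒induced {a} {b} {c} a~b b~c a≢c = record
    { a = a ; b = b ; c = c ; a~b = a~b ; b~c = b~c ; a≢c = a≢c
    ; a≁c = λ a~c → proper a~c (≢-≢⇒≡ (proper a~b) (proper b~c)) }

  module _ {s : ℕ} (free : Free (sP1+P3 s) G) where

    far-count : (P : InducedP₃ G) → countᵈ (far? P) + 2 ≤ 2 * s
    far-count P = begin
      countᵈ (far? P) + 2
        ≤⟨ +-monoˡ-≤ 2 (countᵈ-∪ (far? P) (coloured? 0ℙ) (coloured? 1ℙ) by-colour) ⟩
      countᵈ (coloured? 0ℙ) + countᵈ (coloured? 1ℙ) + 2
        ≤⟨ double-bound (class-bound 0ℙ) (class-bound 1ℙ) ⟩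
      2 * s
        ∎
      where
      open ≤-Reasoning
      Coloured : Parity → Pred (Vertex G) 0ℓ
      Coloured k x = Far P x × colour x ≡ k
      coloured? : ∀ k → Decidable (Coloured k)
      coloured? k x = far? P x ×-dec (colour x ≟ᴾ k)
      by-colour : Far P ⊆ Coloured 0ℙ ∪ Coloured 1ℙ
      by-colour {x} far-x = by-value (colour x) refl
        where
        by-value : ∀ k → colour x ≡ k → Coloured 0ℙ x ⊎ Coloured 1ℙ x
        by-value 0ℙ eq = inj₁ (far-x , eq)
        by-value 1ℙ eq = inj₂ (far-x , eq)
      class-bound : ∀ k → countᵈ (coloured? k) < s
      class-bound k = far-independent-count free P (coloured? k) proj₁
        λ (_ , x≡k) (_ , y≡k) x~y → proper x~y (trans x≡k (sym y≡k))

    module _ {D : Pred (Vertex G) 0ℓ} (D? : Decidable D) {y p : Vertex G}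
             (boundary : ∀ {x u} → D x → ¬ D u → Adj G x u → x ≡ y × u ≡ p) where

      separated-P₃s-bound : (P Q : InducedP₃ G) → All D (InducedP₃.corners P) → All (∁ D) (InducedP₃.corners Q) →
                      n G + 2 ≤ 4 * s
      separated-P₃s-bound P Q P⊆D Q⊆∁D = begin
        n G + 2                                         ≤⟨ +-monoˡ-≤ 2 vertex-bound ⟩
        countᵈ (far? Q) + (countᵈ (far? P) + 2) + 2     ≡⟨ rearrange (countᵈ (far? Q)) (countᵈ (far? P)) ⟩
        (countᵈ (far? Q) + 2) + (countᵈ (far? P) + 2)   ≤⟨ +-mono-≤ (far-count Q) (far-count P) ⟩
        2 * s + 2 * s                                   ≡⟨ double s ⟩
        4 * s                                           ∎
        where
        open ≤-Reasoning
        rearrange : ∀ q p → q + (p + 2) + 2 ≡ (q + 2) + (p + 2)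
        rearrange = solve-∀
        double : ∀ s → 2 * s + 2 * s ≡ 4 * s
        double = solve-∀
        inside-far : ∀ {x} → D x → x ≢ y → Far Q x
        inside-far Dx x≢y = All.map (λ ¬Dt → (λ x≡t → ¬Dt (subst D x≡t Dx)) ,
                                              (λ t~x → x≢y (proj₁ (boundary Dx ¬Dt (Adj-sym t~x))))) Q⊆∁D
        outside-far : ∀ {x} → ¬ D x → x ≢ p → Far P x
        outside-far ¬Dx x≢p = All.map (λ Dt → (λ x≡t → ¬Dx (subst D (sym x≡t) Dt)) ,
                                              (λ t~x → x≢p (proj₂ (boundary Dt ¬Dx t~x)))) P⊆D
        ends? : Decidable ((_≡ y) ∪ (_≡ p))
        ends? = (_≟ y) ∪? (_≟ p)
        rest? : Decidable (Far P ∪ ((_≡ y) ∪ (_≡ p)))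
        rest? = far? P ∪? ends?
        cover : ∀ x → Far Q x ⊎ (Far P ∪ ((_≡ y) ∪ (_≡ p))) x
        cover x with D? x | x ≟ y | x ≟ p
        ... | yes Dx  | yes x≡y | _       = inj₂ (inj₂ (inj₁ x≡y))
        ... | yes Dx  | no x≢y  | _       = inj₁ (inside-far Dx x≢y)
        ... | no ¬Dx  | _       | yes x≡p = inj₂ (inj₂ (inj₂ x≡p))
        ... | no ¬Dx  | _       | no x≢p  = inj₂ (inj₁ (outside-far ¬Dx x≢p))
        vertex-bound : n G ≤ countᵈ (far? Q) + (countᵈ (far? P) + 2)
        vertex-bound = begin
          n G
            ≤⟨ covering (far? Q) rest? cover ⟩
          countᵈ (far? Q) + countᵈ rest?
            ≤⟨ +-monoʳ-≤ (countᵈ (far? Q)) (countᵈ-∪ rest? (far? P) ends? id) ⟩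
          countᵈ (far? Q) + (countᵈ (far? P) + countᵈ ends?)
            ≤⟨ +-monoʳ-≤ (countᵈ (far? Q)) (+-monoʳ-≤ (countᵈ (far? P)) ends≤2) ⟩
          countᵈ (far? Q) + (countᵈ (far? P) + 2)
            ∎
          where
          ends≤2 : countᵈ ends? ≤ 2
          ends≤2 = ≤-trans (countᵈ-∪ ends? (_≟ y) (_≟ p) id)
                           (+-mono-≤ (countᵈ-≤1 (_≟ y) id) (countᵈ-≤1 (_≟ p) id))

Linked-prefix : ∀ {A : Set} {R : A → A → Set} {x y : A} xs {zs} →
                Linked R (x ∷ xs ++ y ∷ zs) → Linked R (x ∷ xs ++ [ y ])
Linked-prefix []       (x~y ∷ _)   = x~y ∷ [-]
Linked-prefix (_ ∷ xs) (x~x′ ∷ xs~) = x~x′ ∷ Linked-prefix xs xs~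

Unique-prefix : ∀ {A : Set} {y : A} xs {zs} → Unique (xs ++ y ∷ zs) → Unique (y ∷ xs)
Unique-prefix []       _               = [] ∷ []
Unique-prefix (x ∷ xs) (x∉ ∷ unique) with y∉xs ∷ xs-unique ← Unique-prefix xs unique =
  ((λ y≡x → All.lookup x∉ (∈-++⁺ʳ xs (here refl)) (sym y≡x)) ∷ y∉xs) ∷ (++⁻ˡ xs x∉ ∷ xs-unique)

module NonBacktracking (G : Graph) (acyclic : Acyclic G) where
  open Adjacency G

  -- A walk from r to v that never immediately goes back along the edge it came by;
  -- m is the vertex preceding v (nothing for the empty walk).
  data Path (r : Vertex G) : Maybe (Vertex G) → Vertex G → Set where
    start  : Path r nothing r
    extend : ∀ {m u v} → Path r m u → Adj G u v → m ≢ just v → Path r (just u) v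

  module _ {r : Vertex G} where

    trail : ∀ {m v} → Path r m v → List (Vertex G)
    trail start                     = []
    trail (extend {u = u} p _ _)    = u ∷ trail p

    vertices : ∀ {m v} → Path r m v → List (Vertex G)
    vertices {v = v} p = v ∷ trail p

    vertices-linked : ∀ {m v} (p : Path r m v) → Linked (Adj G) (vertices p)
    vertices-linked start                = [-]
    vertices-linked (extend p u~v _)     = Adj-sym u~v ∷ vertices-linked p

    root∈trail : ∀ {u v} (p : Path r (just u) v) → r ∈ trail p
    root∈trail (extend start _ _)            = here refl
    root∈trail (extend p@(extend _ _ _) _ _) = there (root∈trail p)

    mutual
      vertices-unique : ∀ {m v} (p : Path r m v) → Unique (vertices p)
      vertices-unique start              = [] ∷ []
      vertices-unique (extend p u~v m≢v) = ¬Any⇒All¬ _ (fresh p u~v m≢v) ∷ vertices-unique p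

      -- Revisiting a vertex without backtracking would close a cycle of length at least 3.
      fresh : ∀ {m u v} (p : Path r m u) → Adj G u v → m ≢ just v → v ∉ vertices p
      fresh _ u~v _ (here refl) = Adj-irrefl u~v
      fresh (extend {u = t} p t~u _) u~v m≢v (there (here refl)) = m≢v refl
      fresh {u = u} {v} (extend {u = t} p t~u m≢u) u~v m≢v (there (there v∈trail))
        with ys , zs , trail≡ ← ∈-∃++ v∈trail =
        acyclic v (u ∷ t ∷ ys) (s≤s (s≤s z≤n) , unique , linked)
        where
        tys-unique : Unique (v ∷ t ∷ ys)
        tys-unique = Unique-prefix (t ∷ ys) (subst (λ l → Unique (t ∷ l)) trail≡ (vertices-unique p))
        u∉tys : All (u ≢_) (t ∷ ys)
        u∉tys = All.tabulate λ {w} w∈ u≡w →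
          fresh p t~u m≢u (subst (_∈ vertices p) (sym u≡w)
                                 (subst (w ∈_) (cong (t ∷_) (sym trail≡)) (∈-++⁺ˡ w∈)))
        unique : Unique (v ∷ u ∷ t ∷ ys)
        unique with v∉tys ∷ tys-unique′ ← tys-unique =
          (≢-sym (Adj⇒≢ u~v) ∷ v∉tys) ∷ u∉tys ∷ tys-unique′
        linked : Linked (Adj G) (v ∷ u ∷ t ∷ ys ++ [ v ])
        linked = Adj-sym u~v ∷ Adj-sym t~u ∷
                 Linked-prefix ys (subst (λ l → Linked (Adj G) (t ∷ l)) trail≡ (vertices-linked p))

    no-return : ∀ {u} → ¬ Path r (just u) r
    no-return p with r∉trail ∷ _ ← vertices-unique p = All.lookup r∉trail (root∈trail p) refl

    retract : ∀ {u v} → Path r (just u) v → Σ (Maybe (Vertex G)) λ m → Path r m u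
    retract (extend p _ _) = _ , p

    walk⇒path : ∀ {m u v} → Path r m u → Walk G u v → Σ (Maybe (Vertex G)) λ m′ → Path r m′ v
    walk⇒path p here = _ , p
    walk⇒path {m} p (step {v = w} u~w walk) with MaybeP.≡-dec _≟_ m (just w)
    ... | yes refl = walk⇒path (proj₂ (retract p)) walk
    ... | no m≢w   = walk⇒path (extend p u~w m≢w) walk

  -- Going back along q turns a disagreement of last steps into a non-backtracking closed walk.
  splice : ∀ {r r′ m m′ v} → Path r m v → Path r′ m′ v → m ≢ m′ → Σ (Vertex G) λ u → Path r (just u) r′
  splice {m = nothing} p start m≢m′ = ⊥-elim (m≢m′ refl)
  splice {m = just u}  p start _    = u , p
  splice p (extend q w~v m″≢v) m≢just-w = splice (extend p (Adj-sym w~v) m≢just-w) q (m″≢v ∘ sym)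

  module _ {r : Vertex G} where

    last-step-unique : ∀ {m m′ v} → Path r m v → Path r m′ v → m ≡ m′
    last-step-unique {m} {m′} p q with MaybeP.≡-dec _≟_ m m′
    ... | yes m≡m′ = m≡m′
    ... | no m≢m′  = ⊥-elim (no-return (proj₂ (splice p q m≢m′)))

    trail-unique : ∀ {m m′ v} (p : Path r m v) (q : Path r m′ v) → trail p ≡ trail q
    trail-unique start start = refl
    trail-unique start q@(extend _ _ _) with () ← last-step-unique start q
    trail-unique p@(extend _ _ _) start with () ← last-step-unique p start
    trail-unique (extend p u~v m≢v) (extend q u′~v m′≢v)
      with refl ← last-step-unique (extend p u~v m≢v) (extend q u′~v m′≢v) = cong (_ ∷_) (trail-unique p q)

record Rooting (G : Graph) (r : Vertex G) : Set where
  field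
    parent          : Vertex G → Maybe (Vertex G)
    depth           : Vertex G → ℕ
    depth-root      : depth r ≡ 0
    parentless⇒root : ∀ {v} → parent v ≡ nothing → v ≡ r
    parent-adjacent : ∀ {u v} → parent v ≡ just u → Adj G u v
    depth-parent    : ∀ {u v} → parent v ≡ just u → depth v ≡ suc (depth u)
    adjacent⇒parent : ∀ {u v} → Adj G u v → parent u ≡ just v ⊎ parent v ≡ just u

rooting : (G : Graph) → Connected G → Acyclic G → (r : Vertex G) → Rooting G r
rooting G connected acyclic r = record
  { parent          = parent
  ; depth           = depth
  ; depth-root      = cong length (trail-unique (path-to r) start)
  ; parentless⇒root = λ eq → start-ends-at-root (path-from eq)
  ; parent-adjacent = λ eq → last-edge (path-from eq)
  ; depth-parent    = depth-parent
  ; adjacent⇒parent = adjacent⇒parent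
  }
  where
  open NonBacktracking G acyclic

  path-to : ∀ v → Path r _ v
  path-to v = proj₂ (walk⇒path start (connected r v))

  parent : Vertex G → Maybe (Vertex G)
  parent v = proj₁ (walk⇒path start (connected r v))

  depth : Vertex G → ℕ
  depth v = length (trail (path-to v))

  path-from : ∀ {m v} → parent v ≡ m → Path r m v
  path-from {v = v} eq = subst (λ m → Path r m v) eq (path-to v)

  start-ends-at-root : ∀ {v} → Path r nothing v → v ≡ r
  start-ends-at-root start = refl

  last-edge : ∀ {u v} → Path r (just u) v → Adj G u v
  last-edge (extend _ u~v _) = u~v

  depth-parent : ∀ {u v} → parent v ≡ just u → depth v ≡ suc (depth u)
  depth-parent {u} {v} eq with path-from eq | trail-unique (path-to v) (path-from eq)
  ... | extend p _ _ | trail≡ = trans (cong length trail≡) (cong suc (cong length (trail-unique p (path-to u))))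

  adjacent⇒parent : ∀ {u v} → Adj G u v → parent u ≡ just v ⊎ parent v ≡ just u
  adjacent⇒parent {u} {v} u~v with MaybeP.≡-dec _≟_ (parent u) (just v)
  ... | yes eq  = inj₁ eq
  ... | no ¬eq = inj₂ (last-step-unique (path-to v) (extend (path-to u) u~v ¬eq))

parity-suc≢ : ∀ d → parity (suc d) ≢ parity d
parity-suc≢ d eq = p≢p⁻¹ (parity (suc d)) (trans eq (sym (suc-homo-⁻¹ d)))

module Rooted {G : Graph} {r : Vertex G} (ρ : Rooting G r) where
  open Rooting ρ public using (depth; depth-root)
  private module ρ = Rooting ρ
  open Adjacency G

  -- A record rather than an equation, so that u and v can be inferred from a proof.
  record ParentOf (u v : Vertex G) : Set where
    constructor parent≡
    field parent-eq : ρ.parent v ≡ just u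

  parent-adjacent : ∀ {u v} → ParentOf u v → Adj G u v
  parent-adjacent (parent≡ eq) = ρ.parent-adjacent eq

  depth-parent : ∀ {u v} → ParentOf u v → depth v ≡ suc (depth u)
  depth-parent (parent≡ eq) = ρ.depth-parent eq

  adjacent⇒parent : ∀ {u v} → Adj G u v → ParentOf v u ⊎ ParentOf u v
  adjacent⇒parent u~v = Sum.map parent≡ parent≡ (ρ.adjacent⇒parent u~v)

  parent-unique : ∀ {u u′ v} → ParentOf u v → ParentOf u′ v → u ≡ u′
  parent-unique (parent≡ u⋖v) (parent≡ u′⋖v) = MaybeP.just-injective (trans (sym u⋖v) u′⋖v)

  parent-depth : ∀ {u v} → ParentOf u v → depth u < depth v
  parent-depth u⋖v = ≤-reflexive (sym (depth-parent u⋖v))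

  root-parentless : ∀ {u} → ¬ ParentOf u r
  root-parentless u⋖r = 0≢1+n (trans (sym depth-root) (depth-parent u⋖r))

  root-or-child : ∀ v → v ≡ r ⊎ Σ (Vertex G) λ u → ParentOf u v
  root-or-child v = by-parent (ρ.parent v) refl
    where
    by-parent : ∀ m → ρ.parent v ≡ m → v ≡ r ⊎ Σ (Vertex G) λ u → ParentOf u v
    by-parent nothing  eq = inj₁ (ρ.parentless⇒root eq)
    by-parent (just u) eq = inj₂ (u , parent≡ eq)

  depth-zero⇒root : ∀ {v} → depth v ≡ 0 → v ≡ r
  depth-zero⇒root {v} d≡0 with root-or-child v
  ... | inj₁ v≡r      = v≡r
  ... | inj₂ (_ , u⋖v) = ⊥-elim (0≢1+n (trans (sym d≡0) (depth-parent u⋖v)))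

  parent-exists : ∀ {v} → v ≢ r → Σ (Vertex G) λ u → ParentOf u v
  parent-exists {v} v≢r with root-or-child v
  ... | inj₁ v≡r   = ⊥-elim (v≢r v≡r)
  ... | inj₂ u⋖v = u⋖v

  depth-suc⇒parent : ∀ {v k} → depth v ≡ suc k → Σ (Vertex G) λ u → ParentOf u v × depth u ≡ k
  depth-suc⇒parent {v} d≡1+k with v ≟ r
  ... | yes refl = ⊥-elim (0≢1+n (trans (sym depth-root) d≡1+k))
  ... | no v≢r with u , u⋖v ← parent-exists v≢r = u , u⋖v , suc-injective (trans (sym (depth-parent u⋖v)) d≡1+k)

  non-root-depth : ∀ {v} → v ≢ r → 1 ≤ depth v
  non-root-depth v≢r with _ , u⋖v ← parent-exists v≢r = ≤-trans (s≤s z≤n) (parent-depth u⋖v)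

  child : ∀ {p v u} → ParentOf p v → Adj G v u → u ≢ p → ParentOf v u
  child p⋖v v~u u≢p with adjacent⇒parent v~u
  ... | inj₁ u⋖v = ⊥-elim (u≢p (parent-unique u⋖v p⋖v))
  ... | inj₂ v⋖u = v⋖u

  root-child : ∀ {u} → Adj G r u → ParentOf r u
  root-child r~u with adjacent⇒parent r~u
  ... | inj₁ u⋖r = ⊥-elim (root-parentless u⋖r)
  ... | inj₂ r⋖u = r⋖u

  root-neighbour-depth : ∀ {u} → Adj G r u → depth u ≡ 1
  root-neighbour-depth r~u = trans (depth-parent (root-child r~u)) (cong suc depth-root)

  depth-colouring : ProperColouring G (parity ∘ depth)
  depth-colouring {u} {v} u~v with adjacent⇒parent u~v
  ... | inj₁ v⋖u = λ eq → parity-suc≢ (depth v) (trans (cong parity (sym (depth-parent v⋖u))) eq)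
  ... | inj₂ u⋖v = λ eq → parity-suc≢ (depth u) (trans (cong parity (sym (depth-parent u⋖v))) (sym eq))

  same-depth-nonadjacent : ∀ {x y} → depth x ≡ depth y → ¬ Adj G x y
  same-depth-nonadjacent dx≡dy x~y with adjacent⇒parent x~y
  ... | inj₁ y⋖x = <-irrefl (sym dx≡dy) (parent-depth y⋖x)
  ... | inj₂ x⋖y = <-irrefl dx≡dy (parent-depth x⋖y)

  deepest-neighbour-is-parent : ∀ {ℓ u} → (∀ v → depth v ≤ depth ℓ) → Adj G ℓ u → ParentOf u ℓ
  deepest-neighbour-is-parent deepest ℓ~u =
    [ id , (λ ℓ⋖u → ⊥-elim (<⇒≱ (parent-depth ℓ⋖u) (deepest _))) ]′ (adjacent⇒parent ℓ~u)

  deepest⇒leaf : ∀ {ℓ} → (∀ v → depth v ≤ depth ℓ) → deg G ℓ ≤ 1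
  deepest⇒leaf {ℓ} deepest with root-or-child ℓ
  ... | inj₁ refl      =
    countᵈ-≤1 (adjacent? ℓ) {z = r} (⊥-elim ∘ root-parentless ∘ deepest-neighbour-is-parent deepest)
  ... | inj₂ (p , p⋖ℓ) =
    countᵈ-≤1 (adjacent? ℓ) (λ ℓ~u → parent-unique (deepest-neighbour-is-parent deepest ℓ~u) p⋖ℓ)

  path-depth-injective : (∀ v → deg G v ≤ 2) → deg G r ≤ 1 → ∀ {x y} → depth x ≡ depth y → x ≡ y
  path-depth-injective deg≤2 root-leaf {y = y} dx≡dy = same-generation (depth y) dx≡dy refl
    where
    same-generation : ∀ k {x y} → depth x ≡ k → depth y ≡ k → x ≡ y
    same-generation zero dx dy = trans (depth-zero⇒root dx) (sym (depth-zero⇒root dy))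
    same-generation (suc k) {x} {y} dx dy
      with p , p⋖x , dp ← depth-suc⇒parent dx
      with p′ , p′⋖y , dp′ ← depth-suc⇒parent dy
      with refl ← same-generation k dp dp′
      with x ≟ y | root-or-child p
    ... | yes x≡y | _              = x≡y
    ... | no x≢y  | inj₁ refl      =
      ⊥-elim (<⇒≱ (two-neighbours (parent-adjacent p⋖x) (parent-adjacent p′⋖y) x≢y) root-leaf)
    ... | no x≢y  | inj₂ (q , q⋖p) =
      ⊥-elim (<⇒≱ (three-neighbours (Adj-sym (parent-adjacent q⋖p)) (parent-adjacent p⋖x) (parent-adjacent p′⋖y)
                                     (older q⋖p p⋖x) (older q⋖p p′⋖y) x≢y) (deg≤2 p))
      where
      older : ∀ {q p x} → ParentOf q p → ParentOf p x → q ≢ x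
      older q⋖p p⋖x refl = <-asym (parent-depth q⋖p) (parent-depth p⋖x)

  infix 4 _≼_ _≼?_

  -- y ≼ x: x lies in the subtree rooted at y.
  data _≼_ (y : Vertex G) : Vertex G → Set where
    ≼-refl  : y ≼ y
    ≼-child : ∀ {x c} → y ≼ x → ParentOf x c → y ≼ c

  ≼-depth : ∀ {y x} → y ≼ x → x ≡ y ⊎ depth y < depth x
  ≼-depth ≼-refl = inj₁ refl
  ≼-depth (≼-child y≼x x⋖c) =
    inj₂ ([ (λ { refl → parent-depth x⋖c }) , (λ y<x → <-trans y<x (parent-depth x⋖c)) ]′ (≼-depth y≼x))

  ≼-shallow : ∀ {y x} → depth x ≤ depth y → x ≢ y → ¬ y ≼ x
  ≼-shallow x≤y x≢y y≼x = [ x≢y , (λ y<x → <⇒≱ y<x x≤y) ]′ (≼-depth y≼x)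

  ≼-deeper : ∀ {y x} → depth x < depth y → ¬ y ≼ x
  ≼-deeper x<y = ≼-shallow (<⇒≤ x<y) λ { refl → <-irrefl refl x<y }

  ≼-parent : ∀ {y x u} → y ≼ x → x ≢ y → ParentOf u x → y ≼ u
  ≼-parent ≼-refl              x≢y _    = ⊥-elim (x≢y refl)
  ≼-parent (≼-child y≼x′ x′⋖x) _   u⋖x = subst (_ ≼_) (parent-unique x′⋖x u⋖x) y≼x′

  _≼?_ : ∀ y x → Dec (y ≼ x)
  y ≼? x = decide (depth x) x refl
    where
    decide : ∀ k x → depth x ≡ k → Dec (y ≼ x)
    decide k x dx with x ≟ y | root-or-child x
    ... | yes refl | _             = yes ≼-refl
    ... | no x≢y   | inj₁ refl     = no λ where
      ≼-refl          → x≢y refl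
      (≼-child _ u⋖r) → root-parentless u⋖r
    ... | no x≢y   | inj₂ (u , u⋖x) with k | dx
    ...   | zero  | d≡0   = ⊥-elim (0≢1+n (trans (sym d≡0) (depth-parent u⋖x)))
    ...   | suc k | d≡1+k = Dec.map′ (λ y≼u → ≼-child y≼u u⋖x) (λ y≼x → ≼-parent y≼x x≢y u⋖x)
                                  (decide k u (suc-injective (trans (sym (depth-parent u⋖x)) d≡1+k)))

  descendants-boundary : ∀ {p y x u} → ParentOf p y → y ≼ x → ¬ y ≼ u → Adj G x u → x ≡ y × u ≡ p
  descendants-boundary {y = y} {x} p⋖y y≼x y⋠u x~u with adjacent⇒parent x~u
  ... | inj₂ x⋖u = ⊥-elim (y⋠u (≼-child y≼x x⋖u))
  ... | inj₁ u⋖x with x ≟ y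
  ...   | yes refl = refl , parent-unique u⋖x p⋖y
  ...   | no x≢y   = ⊥-elim (y⋠u (≼-parent y≼x x≢y u⋖x))

m∸2<n⇒m<2+n : ∀ {m n} → m ∸ 2 < n → m < 2 + n
m∸2<n⇒m<2+n {m} {n} m∸2<n = ≤-trans (s≤s (m≤n+m∸n m 2)) (+-monoʳ-≤ 2 m∸2<n)

4s∸2<1+d+ℓ⇒3s≤d+1 : ∀ {s d ℓ} → 4 * s ∸ 2 < 1 + (d + ℓ) → ℓ < s → 3 * s ≤ d + 1
4s∸2<1+d+ℓ⇒3s≤d+1 {s} {d} {ℓ} 4s∸2< ℓ<s = +-cancelˡ-≤ (s + ℓ + 2) (3 * s) (d + 1) (begin
  s + ℓ + 2 + 3 * s       ≡⟨ lhs s ℓ ⟩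
  (1 + 4 * s) + (1 + ℓ)   ≤⟨ +-mono-≤ (m∸2<n⇒m<2+n 4s∸2<) ℓ<s ⟩
  2 + (1 + (d + ℓ)) + s   ≡⟨ rhs s d ℓ ⟩
  s + ℓ + 2 + (d + 1)     ∎)
  where
  open ≤-Reasoning
  lhs : ∀ s ℓ → s + ℓ + 2 + 3 * s ≡ (1 + 4 * s) + (1 + ℓ)
  lhs = solve-∀
  rhs : ∀ s d ℓ → 2 + (1 + (d + ℓ)) + s ≡ s + ℓ + 2 + (d + 1)
  rhs = solve-∀

2+[s+s]≤7⊔[4s∸2] : ∀ s → 2 + (s + s) ≤ 7 ⊔ (4 * s ∸ 2)
2+[s+s]≤7⊔[4s∸2] s with s ≤? 2
... | yes s≤2 = ≤-trans (+-monoʳ-≤ 2 (+-mono-≤ s≤2 s≤2)) (≤-trans (n≤1+n 6) (m≤m⊔n 7 (4 * s ∸ 2)))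
... | no s≰2  = ≤-trans (m+n≤o⇒m≤o∸n (2 + (s + s)) (begin
    2 + (s + s) + 2       ≡⟨ rearrange s ⟩
    (2 + 2) + (s + s)     ≤⟨ +-monoˡ-≤ (s + s) (+-mono-≤ 2≤s 2≤s) ⟩
    (s + s) + (s + s)     ≡⟨ quadruple s ⟩
    4 * s                 ∎)) (m≤n⊔m 7 (4 * s ∸ 2))
  where
  open ≤-Reasoning
  2≤s : 2 ≤ s
  2≤s = <⇒≤ (≰⇒> s≰2)
  rearrange : ∀ s → 2 + (s + s) + 2 ≡ (2 + 2) + (s + s)
  rearrange = solve-∀
  quadruple : ∀ s → (s + s) + (s + s) ≡ 4 * s
  quadruple = solve-∀

count-≡ᵇ : ∀ {m} (f : Fin m → ℕ) k → count (λ v → f v ≡ᵇ k) ≡ countᵈ (λ v → f v ≟ℕ k)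
count-≡ᵇ f k = countᵈ-≐ (T? ∘ (λ v → f v ≡ᵇ k)) (λ v → f v ≟ℕ k) ((≡ᵇ⇒≡ _ _) , (≡⇒≡ᵇ _ _))

module _ {R : Graph} {s : ℕ} (free : Free (sP1+P3 s) R) (large : 7 ⊔ (4 * s ∸ 2) < n R) where
  open Adjacency R

  private
    4s∸2<n : 4 * s ∸ 2 < n R
    4s∸2<n = ≤-<-trans (m≤n⊔m 7 (4 * s ∸ 2)) large

  module Separation {r : Vertex R} (ρ : Rooting R r) where
    open Rooted ρ
    open Bipartite {R} {parity ∘ depth} depth-colouring public

    no-separated-P₃s : ∀ {p y} → ParentOf p y → (P Q : InducedP₃ R) →
                    All (y ≼_) (InducedP₃.corners P) → All (λ x → ¬ y ≼ x) (InducedP₃.corners Q) → ⊥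
    no-separated-P₃s {y = y} p⋖y P Q P-inside Q-outside =
      <⇒≱ 4s∸2<n (m+n≤o⇒m≤o∸n (n R)
        (separated-P₃s-bound free (y ≼?_) (descendants-boundary p⋖y) P Q P-inside Q-outside))

    ancestral-P₃ : ∀ {a b c} → ParentOf b a → ParentOf c b → InducedP₃ R
    ancestral-P₃ {a} {b} {c} b⋖a c⋖b =
      path⇒induced {a} {b} {c} (Adj-sym (parent-adjacent b⋖a)) (Adj-sym (parent-adjacent c⋖b))
      λ { refl → <-asym (parent-depth b⋖a) (parent-depth c⋖b) }

    no-fifth-generation : ∀ {x k} → depth x ≡ 5 + k → ⊥
    no-fifth-generation {x} dx
      with x₁ , x₁⋖x , d₁ ← depth-suc⇒parent dx
      with x₂ , x₂⋖x₁ , d₂ ← depth-suc⇒parent d₁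
      with x₃ , x₃⋖x₂ , d₃ ← depth-suc⇒parent d₂
      with x₄ , x₄⋖x₃ , d₄ ← depth-suc⇒parent d₃
      with x₅ , x₅⋖x₄ , _  ← depth-suc⇒parent d₄ =
      no-separated-P₃s x₃⋖x₂ (ancestral-P₃ x₁⋖x x₂⋖x₁) (ancestral-P₃ x₄⋖x₃ x₅⋖x₄)
        (≼-child (≼-child ≼-refl x₂⋖x₁) x₁⋖x ∷ ≼-child ≼-refl x₂⋖x₁ ∷ ≼-refl ∷ [])
        (≼-deeper x₃<x₂ ∷ ≼-deeper (<-trans (parent-depth x₄⋖x₃) x₃<x₂)
          ∷ ≼-deeper (<-trans (parent-depth x₅⋖x₄) (<-trans (parent-depth x₄⋖x₃) x₃<x₂)) ∷ [])
      where
      x₃<x₂ : depth x₃ < depth x₂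
      x₃<x₂ = parent-depth x₃⋖x₂

    depth<5 : ∀ x → depth x < 5
    depth<5 x with 5 ≤? depth x
    ... | no 5≰ = ≰⇒> 5≰
    ... | yes 5≤ = ⊥-elim (no-fifth-generation (sym (m+[n∸m]≡n 5≤)))

  module MaxDegreeRoot (tree : IsTree R) (r : Vertex R) (r-max : ∀ v → deg R v ≤ deg R r) where
    private
      connected : Connected R
      connected = proj₁ (proj₂ tree)
      acyclic : Acyclic R
      acyclic = proj₂ (proj₂ tree)

    open Rooted (rooting R connected acyclic r)
    open Separation (rooting R connected acyclic r)

    -- Otherwise R is a path; rooted at an end its depths are distinct and below 5.
    root-degree : 3 ≤ deg R r
    root-degree with 3 ≤? deg R r
    ... | yes 3≤deg = 3≤deg
    ... | no 3≰deg  =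
      ⊥-elim (<⇒≱ large (≤-trans at-most-five (≤-trans (m≤n⇒m≤1+n (n≤1+n 5)) (m≤m⊔n 7 (4 * s ∸ 2)))))
      where
      ℓ : Vertex R
      ℓ = argmax depth r (allFin (n R))
      module Leaf = Rooted (rooting R connected acyclic ℓ)
      module LeafSeparation = Separation (rooting R connected acyclic ℓ)
      at-most-five : n R ≤ 5
      at-most-five = injective⇒≤ {f = λ v → fromℕ< (LeafSeparation.depth<5 v)} λ {x} {y} eq →
        Leaf.path-depth-injective (λ v → ≤-trans (r-max v) (≤-pred (≰⇒> 3≰deg)))
          (deepest⇒leaf λ v → All.lookup (f[xs]≤f[argmax] {f = depth} r (allFin (n R))) (∈-allFin v))
          (trans (sym (toℕ-fromℕ< _)) (trans (cong toℕ eq) (toℕ-fromℕ< _)))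

    root-P₃-avoiding : ∀ {y} → y ≢ r → Σ (InducedP₃ R) λ Q → All (λ x → ¬ y ≼ x) (InducedP₃.corners Q)
    root-P₃-avoiding {y} y≢r
      with w₁ , w₂ , (r~w₁ , w₁≢y) , (r~w₂ , w₂≢y) , w₁≢w₂ ← distinct-pair (neighbours-avoiding root-degree y) =
      path⇒induced {w₁} {r} {w₂} (Adj-sym r~w₁) r~w₂ w₁≢w₂ ,
      outside r~w₁ w₁≢y ∷ ≼-shallow (≤-trans (≤-reflexive depth-root) z≤n) (≢-sym y≢r) ∷ outside r~w₂ w₂≢y ∷ []
      where
      outside : ∀ {w} → Adj R r w → w ≢ y → ¬ y ≼ w
      outside r~w = ≼-shallow (subst (_≤ depth y) (sym (root-neighbour-depth r~w)) (non-root-depth y≢r))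

    non-root-degree : ∀ {v} → v ≢ r → deg R v ≤ 2
    non-root-degree {v} v≢r with 3 ≤? deg R v
    ... | no 3≰deg = ≤-pred (≰⇒> 3≰deg)
    ... | yes 3≤deg
      with p , p⋖v ← parent-exists v≢r
      with c₁ , c₂ , (v~c₁ , c₁≢p) , (v~c₂ , c₂≢p) , c₁≢c₂ ← distinct-pair (neighbours-avoiding 3≤deg p)
      with Q , Q-outside ← root-P₃-avoiding v≢r =
      ⊥-elim (no-separated-P₃s p⋖v (path⇒induced {c₁} {v} {c₂} (Adj-sym v~c₁) v~c₂ c₁≢c₂) Q
        (≼-child ≼-refl (child p⋖v v~c₁ c₁≢p) ∷ ≼-refl ∷ ≼-child ≼-refl (child p⋖v v~c₂ c₂≢p) ∷ []) Q-outside)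

    degree-two-non-root : ∀ {v} → deg R v ≡ 2 → v ≢ r
    degree-two-non-root deg≡2 refl = <⇒≱ root-degree (≤-reflexive deg≡2)

    degree-two⇒root-neighbour : ∀ {v} → deg R v ≡ 2 → Adj R r v
    degree-two⇒root-neighbour {v} deg≡2
      with p , p⋖v ← parent-exists (degree-two-non-root deg≡2)
      with root-or-child p
    ... | inj₁ refl = parent-adjacent p⋖v
    ... | inj₂ (q , q⋖p)
      with c , v~c , c≢p ← distinct-one (neighbours-avoiding (≤-reflexive (sym deg≡2)) p)
      with Q , Q-outside ← root-P₃-avoiding (λ { refl → root-parentless q⋖p }) =
      ⊥-elim (no-separated-P₃s q⋖p (path⇒induced {c} {v} {p} (Adj-sym v~c) (Adj-sym (parent-adjacent p⋖v)) c≢p) Q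
        (≼-child (≼-child ≼-refl p⋖v) (child p⋖v v~c c≢p) ∷ ≼-child ≼-refl p⋖v ∷ ≼-refl ∷ []) Q-outside)

    middle-degree : ∀ {p v c} → ParentOf p v → ParentOf v c → deg R v ≡ 2
    middle-degree p⋖v v⋖c = ≤-antisym (non-root-degree λ { refl → root-parentless p⋖v })
      (two-neighbours (Adj-sym (parent-adjacent p⋖v)) (parent-adjacent v⋖c)
        λ { refl → <-asym (parent-depth p⋖v) (parent-depth v⋖c) })

    degree-two-child : ∀ {m} → deg R m ≡ 2 → Σ (Vertex R) λ c → ParentOf m c × depth c ≡ 2
    degree-two-child {m} deg≡2 with c , m~c , c≢r ← distinct-one (neighbours-avoiding (≤-reflexive (sym deg≡2)) r) =
      c , m⋖c , trans (depth-parent m⋖c) (cong suc (root-neighbour-depth r~m))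
      where
      r~m : Adj R r m
      r~m = degree-two⇒root-neighbour deg≡2
      m⋖c : ParentOf m c
      m⋖c = child (root-child r~m) m~c c≢r

    trichotomy : ∀ x → x ≡ r ⊎ Adj R r x ⊎ depth x ≡ 2
    trichotomy x with root-or-child x
    ... | inj₁ x≡r = inj₁ x≡r
    ... | inj₂ (p , p⋖x) with root-or-child p
    ...   | inj₁ refl        = inj₂ (inj₁ (parent-adjacent p⋖x))
    ...   | inj₂ (q , q⋖p)   = inj₂ (inj₂ (trans (depth-parent p⋖x)
                                 (cong suc (root-neighbour-depth (degree-two⇒root-neighbour (middle-degree q⋖p p⋖x))))))

    depth-two? : Decidable (λ x → depth x ≡ 2)
    depth-two? x = depth x ≟ℕ 2

    degree-two? : Decidable (λ x → deg R x ≡ 2)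
    degree-two? x = deg R x ≟ℕ 2

    vertex-count : n R ≤ 1 + (deg R r + countᵈ depth-two?)
    vertex-count = ≤-trans (covering (_≟ r) (adjacent? r ∪? depth-two?) trichotomy)
      (+-mono-≤ (countᵈ-≤1 (_≟ r) id) (countᵈ-∪ (adjacent? r ∪? depth-two?) (adjacent? r) depth-two? id))

    degree-two≤depth-two : countᵈ degree-two? ≤ countᵈ depth-two?
    degree-two≤depth-two = countᵈ-injection degree-two? depth-two?
      (proj₁ ∘ degree-two-child) (proj₂ ∘ proj₂ ∘ degree-two-child)
      λ m₂ m′₂ eq → parent-unique (proj₁ (proj₂ (degree-two-child m₂)))
                                  (subst (ParentOf _) (sym eq) (proj₁ (proj₂ (degree-two-child m′₂))))

    depth-two-independent : Independent R (λ x → depth x ≡ 2)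
    depth-two-independent x₂ y₂ = same-depth-nonadjacent (trans x₂ (sym y₂))

    root-far : ∀ {x} → depth x ≡ 2 → x ≢ r × ¬ Adj R r x
    root-far x₂ = (λ { refl → 0≢1+n (trans (sym depth-root) x₂) }) ,
                  (λ r~x → 0≢1+n (suc-injective (trans (sym (root-neighbour-depth r~x)) x₂)))

    pendant-far : ∀ {l x} → Adj R r l → deg R l ≢ 2 → depth x ≡ 2 → x ≢ l × ¬ Adj R l x
    pendant-far r~l deg≢2 x₂ =
      (λ { refl → 0≢1+n (suc-injective (trans (sym (root-neighbour-depth r~l)) x₂)) }) ,
      λ l~x → [ (λ x⋖l → proj₁ (root-far x₂) (parent-unique x⋖l (root-child r~l)))
              , (λ l⋖x → deg≢2 (middle-degree (root-child r~l) l⋖x)) ]′ (adjacent⇒parent l~x)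

    pendant? : Decidable (λ x → Adj R r x × deg R x ≢ 2)
    pendant? x = adjacent? r x ×-dec ¬? (degree-two? x)

    two-pendants⇒depth-two<s : ∀ {l₁ l₂} → Adj R r l₁ × deg R l₁ ≢ 2 → Adj R r l₂ × deg R l₂ ≢ 2 → l₁ ≢ l₂ →
                               countᵈ depth-two? < s
    two-pendants⇒depth-two<s {l₁} {l₂} (r~l₁ , l₁≠2) (r~l₂ , l₂≠2) l₁≢l₂ =
      far-independent-count free (path⇒induced {l₁} {r} {l₂} (Adj-sym r~l₁) r~l₂ l₁≢l₂) depth-two?
        (λ x₂ → pendant-far r~l₁ l₁≠2 x₂ ∷ root-far x₂ ∷ pendant-far r~l₂ l₂≠2 x₂ ∷ [])
        depth-two-independent

    degree-two⇒depth-two≤s : ∀ {m} → deg R m ≡ 2 → countᵈ depth-two? ≤ s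
    degree-two⇒depth-two≤s {m} m₂ with e , m⋖e , e₂ ← degree-two-child m₂ =
      ≤-trans (countᵈ-except depth-two? e) others<s
      where
      r~m : Adj R r m
      r~m = degree-two⇒root-neighbour m₂
      m-far : ∀ {x} → depth x ≡ 2 → x ≢ e → x ≢ m × ¬ Adj R m x
      m-far x₂ x≢e =
        (λ { refl → 0≢1+n (suc-injective (trans (sym (root-neighbour-depth r~m)) x₂)) }) ,
        λ m~x → [ (λ x⋖m → proj₁ (root-far x₂) (parent-unique x⋖m (root-child r~m)))
                , (λ _ → <⇒≱ (three-neighbours (Adj-sym r~m) (parent-adjacent m⋖e) m~x
                                (≢-sym (proj₁ (root-far e₂))) (≢-sym (proj₁ (root-far x₂))) (≢-sym x≢e))
                             (≤-reflexive m₂)) ]′ (adjacent⇒parent m~x)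
      others<s : countᵈ (except? depth-two? e) < s
      others<s = far-independent-count free
        (path⇒induced {e} {m} {r} (Adj-sym (parent-adjacent m⋖e)) (Adj-sym r~m) (proj₁ (root-far e₂)))
        (except? depth-two? e)
        (λ (x₂ , x≢e) → (x≢e , same-depth-nonadjacent (trans e₂ (sym x₂))) ∷ m-far x₂ x≢e ∷ root-far x₂ ∷ [])
        (λ (x₂ , _) (y₂ , _) → depth-two-independent x₂ y₂)

    root-degree≤ : countᵈ pendant? ≤ 1 → deg R r ≤ countᵈ degree-two? + 1
    root-degree≤ ≤1-pendant =
      ≤-trans (countᵈ-∪ (adjacent? r) degree-two? pendant? split) (+-monoʳ-≤ (countᵈ degree-two?) ≤1-pendant)
      where
      split : Adj R r ⊆ (λ x → deg R x ≡ 2) ∪ (λ x → Adj R r x × deg R x ≢ 2)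
      split {x} r~x with degree-two? x
      ... | yes x₂ = inj₁ x₂
      ... | no x≠2 = inj₂ (r~x , x≠2)

    at-most-one-pendant-absurd : countᵈ pendant? ≤ 1 → ⊥
    at-most-one-pendant-absurd ≤1-pendant = <⇒≱ large (begin
      n R                                                  ≤⟨ vertex-count ⟩
      1 + (deg R r + countᵈ depth-two?)                    ≤⟨ +-monoʳ-≤ 1 (+-monoˡ-≤ _ (root-degree≤ ≤1-pendant)) ⟩
      1 + ((countᵈ degree-two? + 1) + countᵈ depth-two?)   ≤⟨ +-monoʳ-≤ 1 (+-mono-≤ (+-monoˡ-≤ 1 degree-two≤s) depth-two≤s) ⟩
      1 + ((s + 1) + s)                                    ≡⟨ rearrange s ⟩
      2 + (s + s)                                          ≤⟨ 2+[s+s]≤7⊔[4s∸2] s ⟩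
      7 ⊔ (4 * s ∸ 2)                                      ∎)
      where
      open ≤-Reasoning
      rearrange : ∀ s → 1 + ((s + 1) + s) ≡ 2 + (s + s)
      rearrange = solve-∀
      some-degree-two : 1 ≤ countᵈ degree-two?
      some-degree-two = ≤-trans (s≤s z≤n)
        (≤-pred (subst (3 ≤_) (+-comm (countᵈ degree-two?) 1) (≤-trans root-degree (root-degree≤ ≤1-pendant))))
      depth-two≤s : countᵈ depth-two? ≤ s
      depth-two≤s = degree-two⇒depth-two≤s (proj₂ (distinct-one (≤countᵈ⇒distinct degree-two? some-degree-two)))
      degree-two≤s : countᵈ degree-two? ≤ s
      degree-two≤s = ≤-trans degree-two≤depth-two depth-two≤s

    structure : (2 < deg R r) × (∀ v → v ≢ r → deg R v ≤ 2) × (count (λ v → deg R v ≡ᵇ 2) + 1 ≤ s)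
                × (∀ v → deg R v ≡ 2 → Adj R r v) × (3 * s ≤ deg R r + 1)
    structure with 2 ≤? countᵈ pendant?
    ... | no ≰1-pendant = ⊥-elim (at-most-one-pendant-absurd (≤-pred (≰⇒> ≰1-pendant)))
    ... | yes two-pendants
      with l₁ , l₂ , l₁-pendant , l₂-pendant , l₁≢l₂ ← distinct-pair (≤countᵈ⇒distinct pendant? two-pendants) =
      root-degree , (λ _ → non-root-degree) ,
      subst (λ k → k + 1 ≤ s) (sym (count-≡ᵇ (deg R) 2))
        (subst (_≤ s) (+-comm 1 _) (≤-<-trans degree-two≤depth-two depth-two<s)) ,
      (λ _ → degree-two⇒root-neighbour) ,
      4s∸2<1+d+ℓ⇒3s≤d+1 (<-≤-trans 4s∸2<n vertex-count) depth-two<s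
      where
      depth-two<s : countᵈ depth-two? < s
      depth-two<s = two-pendants⇒depth-two<s l₁-pendant l₂-pendant l₁≢l₂

lemma6 : (s : ℕ) (R : Graph) → IsTree R → Free (sP1+P3 s) R →
    (n R ≤ 7 ⊔ (4 * s ∸ 2))
    ⊎ (Σ (Fin (n R)) λ r →
         (2 < deg R r)
         × (∀ v → v ≢ r → deg R v ≤ 2)
         × (count (λ v → deg R v ≡ᵇ 2) + 1 ≤ s)
         × (∀ v → deg R v ≡ 2 → Adj R r v)
         × (3 * s ≤ deg R r + 1))
lemma6 s R tree free with n R ≤? 7 ⊔ (4 * s ∸ 2)
... | yes small  = inj₁ small
... | no ¬small  = inj₂ (r , MaxDegreeRoot.structure free (≰⇒> ¬small) tree r r-max)
  where
  some-vertex : Vertex R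
  some-vertex = fromℕ< (proj₁ tree)
  r : Vertex R
  r = argmax (deg R) some-vertex (allFin (n R))
  r-max : ∀ v → deg R v ≤ deg R r
  r-max v = All.lookup (f[xs]≤f[argmax] {f = deg R} some-vertex (allFin (n R))) (∈-allFin v)
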